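{- Let $G$ be a complete wheel with $n\geq6$ vertices, cycle $C=\{c_1,\dots,c_{n-1}\}$ and central vertex $h$. Any set $X\subseteq V$ satisfying the condition "for every $i$, if $c_i,c_{i+1}\notin X$ then $c_{i-2},c_{i-1},c_{i+2},c_{i+3}\in X$" contains at least $\lfloor n/2\rfloor$ cycle vertices. Furthermore, if $L\subseteq V$ satisfies $|L\cap C|\geq4$, then for every $i$ the pair $h,c_i$ is separated by at least two vertices of $L\cap C$; and in this case, if $L$ is an NL-landmark set for parameter $k=2$, then $L\setminus\{h\}$ is also an NL-landmark set for parameter $2$.
   Context: The complete wheel on $n$ vertices has vertex set $V=C\cup\{h\}$ with $C=\{c_1,\dots,c_{n-1}\}$, edges $\{c_i,h\}$ and $\{c_i,c_{i+1}\}$ for $1\le i\le n-1$, indices modulo $n-1$. $d(x,y)$ denotes graph distance; $\tau$ separates distinct $u,v$ if $d(u,\tau)\neq d(v,\tau)$. $L\subseteq V$ is an NL-landmark set for parameter $k$ if every pair of distinct $u,v\in V\setminus L$ is separated by at least $k$ distinct vertices of $L$. -}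

module Defs where

open import Data.Nat using (ℕ; zero; suc; _+_; _∸_; _<_)
open import Data.Nat.DivMod using (_mod_)
open import Data.Fin using (Fin; toℕ)
import Data.Fin as F
open import Data.Fin.Subset using (Subset; _∈_; _∉_)
open import Data.Product using (Σ; _×_)
open import Function.Definitions using (Injective)
open import Relation.Binary.PropositionalEquality using (_≡_; _≢_)
open import Relation.Nullary using (¬_)

-- Complete wheel with cycle length m = suc p, hence n = suc m = 2 + p vertices.
-- Vertex set: Fin (suc (suc p)); F.zero is the hub h, F.suc i is the cycle vertex c_i
-- (i : Fin (suc p), i.e. cycle indices 0 .. m-1, taken modulo m).

V : ℕ → Set
V p = Fin (suc (suc p))

hub : ∀ {p} → V p
hub = F.zero

cyc : ∀ {p} → Fin (suc p) → V p
cyc i = F.suc i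

_⊕_ : ∀ {p} → Fin (suc p) → ℕ → Fin (suc p)
_⊕_ {p} i k = (toℕ i + k) mod (suc p)

data Adj {p : ℕ} : V p → V p → Set where
  hub-cyc  : (i : Fin (suc p)) → Adj hub (cyc i)
  cyc-hub  : (i : Fin (suc p)) → Adj (cyc i) hub
  cyc-next : (i : Fin (suc p)) → Adj (cyc i) (cyc (i ⊕ 1))
  cyc-prev : (i : Fin (suc p)) → Adj (cyc (i ⊕ 1)) (cyc i)

data Walk {p : ℕ} : V p → V p → ℕ → Set where
  nil  : ∀ {x} → Walk x x 0
  cons : ∀ {x y z k} → Adj x y → Walk y z k → Walk x z (suc k)

IsDist : ∀ {p} → V p → V p → ℕ → Set
IsDist x y d = Walk x y d × (∀ k → k < d → ¬ Walk x y k)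

Separates : ∀ {p} → V p → V p → V p → Set
Separates u v τ = ∀ d₁ d₂ → IsDist u τ d₁ → IsDist v τ d₂ → d₁ ≢ d₂

SepByAtLeast : ∀ {p} → ℕ → Subset (suc (suc p)) → V p → V p → Set
SepByAtLeast {p} k L u v =
  Σ (Fin k → V p) λ f → Injective _≡_ _≡_ f × (∀ j → (f j ∈ L) × Separates u v (f j))

NLLandmark : ∀ {p} → ℕ → Subset (suc (suc p)) → Set
NLLandmark {p} k L = ∀ (u v : V p) → u ≢ v → u ∉ L → v ∉ L → SepByAtLeast k L u v

SepByAtLeastCyc : ∀ {p} → ℕ → Subset (suc (suc p)) → V p → V p → Set
SepByAtLeastCyc {p} k L u v =
  Σ (Fin k → Fin (suc p)) λ f → Injective _≡_ _≡_ f
    × (∀ j → (cyc (f j) ∈ L) × Separates u v (cyc (f j)))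

-- the condition on X: if c_i, c_{i+1} ∉ X then c_{i-2}, c_{i-1}, c_{i+2}, c_{i+3} ∈ X
-- (i-2 and i-1 are written as i + (m-2), i + (m-1) modulo m = suc p)
CondX : ∀ {p} → Subset (suc (suc p)) → Set
CondX {p} X = ∀ (i : Fin (suc p)) → cyc i ∉ X → cyc (i ⊕ 1) ∉ X →
  (cyc (i ⊕ (suc p ∸ 2)) ∈ X) × (cyc (i ⊕ (suc p ∸ 1)) ∈ X)
  × (cyc (i ⊕ 2) ∈ X) × (cyc (i ⊕ 3) ∈ X)

module Submission where

-- (1) Read X ∩ C as an m-periodic Boolean sequence x.  The condition on X
-- says that two consecutive absent positions n, n+1 force n+2 and n+3 to be
-- present.  Every absent position is either a single gap (followed by a
-- present position) or a double gap (followed by an absent one).  Charging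
-- the double gap at n and the single gap at n+2 to the position n+3 charges
-- each present position at most once; since sums over a period are invariant
-- under rotation, #absent ≤ #present, so m ≤ 2·|X ∩ C| and ⌊n/2⌋ ≤ |X ∩ C|.
-- (2) d(h, c_j) = 1, whereas d(c_i, c_j) = 1 only for j = i ± 1; hence every
-- cycle vertex of L other than c_{i±1} separates h and c_i, and |L ∩ C| ≥ 4
-- leaves at least two of them.
-- (3) The hub is at distance 1 from all cycle vertices, so it separates no
-- pair of cycle vertices; removing it from L therefore loses no separator of
-- such a pair, and pairs containing h are handled by (2).

open import Defs
open import Data.Nat using (ℕ; zero; suc; _+_; _*_; _∸_; _≤_; _/_; _%_; z≤n; s≤s)
open import Data.Nat.Properties using (+-assoc; +-comm; +-identityʳ; +-cancelˡ-≡; +-mono-≤; +-monoʳ-≤; *-comm; n≤1+n; ≤-pred; ≤-refl; ≤-reflexive; ≤-trans; +-commutativeSemigroup; module ≤-Reasoning)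
open import Data.Nat.DivMod using (_mod_; %-distribˡ-+; m%n%n≡m%n; [m+n]%n≡m%n; m<n⇒m%n≡m; m%n<n; m<n*o⇒m/o<n)
open import Algebra.Properties.CommutativeSemigroup +-commutativeSemigroup using (interchange)
open import Data.Bool using (Bool; true; false; not)
open import Data.Fin using (Fin; toℕ)
import Data.Fin as F
open import Data.Fin.Properties using (toℕ-injective; toℕ-fromℕ<; toℕ<n; suc-injective)
open import Data.Fin.Subset using (Subset; ∣_∣; _-_; _∈_; _∉_; inside; outside; Nonempty)
open import Data.Fin.Subset.Properties using (x∈p∧x≢y⇒x∈p-y; p─q⊆p; nonempty?; Empty-unique; ∣⊥∣≡0)
open import Data.Vec using (Vec; []; _∷_; tail; lookup; there; zipWith; replicate)
open import Data.Vec.Properties using ([]=⇒lookup)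
open import Data.Product using (Σ; _×_; _,_; proj₁; proj₂)
open import Data.Sum using (_⊎_; inj₁; inj₂; [_,_]′)
open import Data.Empty using (⊥-elim)
open import Function using (_∘_)
open import Function.Definitions using (Injective)
open import Relation.Binary.PropositionalEquality
open import Relation.Nullary using (¬_; yes; no)

hub-cyc-distance : ∀ {p} (j : Fin (suc p)) {d : ℕ} → IsDist {p} hub (cyc j) d → d ≡ 1
hub-cyc-distance j {zero} (() , _)
hub-cyc-distance j {suc zero} _ = refl
hub-cyc-distance j {suc (suc d)} (_ , noShorter) =
  ⊥-elim (noShorter 1 (s≤s (s≤s z≤n)) (cons (hub-cyc j) nil))

cyc-hub-distance : ∀ {p} (i : Fin (suc p)) → IsDist {p} (cyc i) hub 1
cyc-hub-distance i = cons (cyc-hub i) nil , λ { zero _ () ; (suc k) (s≤s ()) _ }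

hub-separates-no-cycle-pair : ∀ {p} (i j : Fin (suc p)) → ¬ Separates {p} (cyc i) (cyc j) hub
hub-separates-no-cycle-pair i j separates =
  separates 1 1 (cyc-hub-distance i) (cyc-hub-distance j) refl

cycle-edge : ∀ {p} {i j : Fin (suc p)} → Walk {p} (cyc i) (cyc j) 1 → (j ≡ i ⊕ 1) ⊎ (i ≡ j ⊕ 1)
cycle-edge (cons (cyc-next _) nil) = inj₁ refl
cycle-edge (cons (cyc-prev _) nil) = inj₂ refl

-- A cycle vertex c_j that is not a neighbour of c_i separates h and c_i:
-- d(h, c_j) = 1 while d(c_i, c_j) ≠ 1.
non-neighbour-separates : ∀ {p} (i j : Fin (suc p)) → j ≢ i ⊕ 1 → i ≢ j ⊕ 1 →
  Separates {p} hub (cyc i) (cyc j)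
non-neighbour-separates i j notNext notPrev d₁ d₂ hubDist cycDist d₁≡d₂
  with hub-cyc-distance j hubDist
... | refl = [ notNext , notPrev ]′
  (cycle-edge (subst (Walk (cyc i) (cyc j)) (sym d₁≡d₂) (proj₁ cycDist)))

separates-sym : ∀ {p} {u v τ : V p} → Separates u v τ → Separates v u τ
separates-sym separates d₁ d₂ D₁ D₂ d₁≡d₂ = separates d₂ d₁ D₂ D₁ (sym d₁≡d₂)

module CycleIndex (p : ℕ) where

  m : ℕ
  m = suc p

  toℕ-mod : ∀ n → toℕ (n mod m) ≡ n % m
  toℕ-mod n = toℕ-fromℕ< (m%n<n n m)

  mod-⊕ : ∀ n k → (n mod m) ⊕ k ≡ (n + k) mod m
  mod-⊕ n k = toℕ-injective (begin
      toℕ ((n mod m) ⊕ k)       ≡⟨ toℕ-mod (toℕ (n mod m) + k) ⟩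
      (toℕ (n mod m) + k) % m   ≡⟨ cong (λ r → (r + k) % m) (toℕ-mod n) ⟩
      (n % m + k) % m           ≡⟨ %-distribˡ-+ (n % m) k m ⟩
      (n % m % m + k % m) % m   ≡⟨ cong (λ r → (r + k % m) % m) (m%n%n≡m%n n m) ⟩
      (n % m + k % m) % m       ≡⟨ %-distribˡ-+ n k m ⟨
      (n + k) % m               ≡⟨ toℕ-mod (n + k) ⟨
      toℕ ((n + k) mod m)       ∎)
    where open ≡-Reasoning

  mod-periodic : ∀ n → (n + m) mod m ≡ n mod m
  mod-periodic n = toℕ-injective (begin
      toℕ ((n + m) mod m)   ≡⟨ toℕ-mod (n + m) ⟩
      (n + m) % m           ≡⟨ [m+n]%n≡m%n n m ⟩
      n % m                 ≡⟨ toℕ-mod n ⟨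
      toℕ (n mod m)         ∎)
    where open ≡-Reasoning

  toℕ-mod-id : (i : Fin m) → toℕ i mod m ≡ i
  toℕ-mod-id i = toℕ-injective (trans (toℕ-mod (toℕ i)) (m<n⇒m%n≡m (toℕ<n i)))

  ⊕-assoc : (i : Fin m) (a b : ℕ) → (i ⊕ a) ⊕ b ≡ i ⊕ (a + b)
  ⊕-assoc i a b = trans (mod-⊕ (toℕ i + a) b) (cong (λ r → r mod m) (+-assoc (toℕ i) a b))

  ⊕-period : (i : Fin m) → i ⊕ m ≡ i
  ⊕-period i = trans (mod-periodic (toℕ i)) (toℕ-mod-id i)

  predecessor : {i j : Fin m} → i ≡ j ⊕ 1 → j ≡ i ⊕ p
  predecessor {j = j} refl = sym (trans (⊕-assoc j 1 p) (⊕-period j))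

tail-member : ∀ {p} {L : Subset (suc (suc p))} {j : Fin (suc p)} → j ∈ tail L → cyc j ∈ L
tail-member {L = _ ∷ _} j∈ = there j∈

tail-member⁻ : ∀ {p} {L : Subset (suc (suc p))} {j : Fin (suc p)} → cyc j ∈ L → j ∈ tail L
tail-member⁻ {L = _ ∷ _} (there j∈) = j∈

-- Set difference is computed pointwise, so subtracting the empty set (the tail
-- of ⁅ zero ⁆) leaves a subset unchanged.
pointwise-minus-empty : ∀ {n} (diff : Bool → Bool → Bool) → (∀ s → diff s outside ≡ s) →
  (q : Subset n) → zipWith diff q (replicate n outside) ≡ q
pointwise-minus-empty diff keep [] = refl
pointwise-minus-empty diff keep (s ∷ q) = cong₂ _∷_ (keep s) (pointwise-minus-empty diff keep q)

size-removal : ∀ {n} (q : Subset n) (x : Fin n) → ∣ q ∣ ≤ suc ∣ q - x ∣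
size-removal (inside ∷ q) F.zero =
  ≤-reflexive (cong (suc ∘ ∣_∣) (sym (pointwise-minus-empty _ (λ _ → refl) q)))
size-removal (outside ∷ q) F.zero =
  ≤-trans (≤-reflexive (cong ∣_∣ (sym (pointwise-minus-empty _ (λ _ → refl) q)))) (n≤1+n _)
size-removal (inside ∷ q) (F.suc x) = s≤s (size-removal q x)
size-removal (outside ∷ q) (F.suc x) = size-removal q x

size-two-removals : ∀ {n} (q : Subset n) (a b : Fin n) → 4 ≤ ∣ q ∣ → 2 ≤ ∣ q - a - b ∣
size-two-removals q a b size =
  ≤-pred (≤-pred (≤-trans size (≤-trans (size-removal q a) (s≤s (size-removal (q - a) b)))))

x∉p-x : ∀ {n} (q : Subset n) (x : Fin n) → x ∉ q - x
x∉p-x (_ ∷ q) (F.suc x) (there x∈) = x∉p-x q x x∈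

member-of-removal : ∀ {n} {q : Subset n} {x j : Fin n} → j ∈ q - x → j ∈ q × j ≢ x
member-of-removal {q = q} {x} j∈ =
  p─q⊆p q _ j∈ , λ { refl → x∉p-x q x j∈ }

nonempty-of-size : ∀ {n} (q : Subset n) → 1 ≤ ∣ q ∣ → Nonempty q
nonempty-of-size {n} q size with nonempty? q
... | yes ne = ne
... | no empty with () ← ≤-trans size (≤-reflexive (trans (cong ∣_∣ (Empty-unique empty)) (∣⊥∣≡0 n)))

two-distinct-elements : ∀ {n} (q : Subset n) → 2 ≤ ∣ q ∣ →
  Σ (Fin n) λ a → Σ (Fin n) λ b → a ∈ q × b ∈ q × a ≢ b
two-distinct-elements q size with nonempty-of-size q (≤-trans (s≤s z≤n) size)
... | a , a∈ with nonempty-of-size (q - a) (≤-pred (≤-trans size (size-removal q a)))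
... | b , b∈ with member-of-removal b∈
... | b∈q , b≢a = a , b , a∈ , b∈q , (λ a≡b → b≢a (sym a≡b))

pair : {A : Set} → A → A → Fin 2 → A
pair a b F.zero = a
pair a b (F.suc _) = b

pair-injective : {A : Set} {a b : A} → a ≢ b → Injective _≡_ _≡_ (pair a b)
pair-injective a≢b {F.zero} {F.zero} _ = refl
pair-injective a≢b {F.zero} {F.suc F.zero} a≡b = ⊥-elim (a≢b a≡b)
pair-injective a≢b {F.suc F.zero} {F.zero} b≡a = ⊥-elim (a≢b (sym b≡a))
pair-injective a≢b {F.suc F.zero} {F.suc F.zero} _ = refl

sumBelow : ℕ → (ℕ → ℕ) → ℕ
sumBelow zero g = 0
sumBelow (suc k) g = g 0 + sumBelow k (g ∘ suc)

sum-cong : ∀ k {f g : ℕ → ℕ} → (∀ n → f n ≡ g n) → sumBelow k f ≡ sumBelow k g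
sum-cong zero f≡g = refl
sum-cong (suc k) f≡g = cong₂ _+_ (f≡g 0) (sum-cong k (f≡g ∘ suc))

sum-mono : ∀ k {f g : ℕ → ℕ} → (∀ n → f n ≤ g n) → sumBelow k f ≤ sumBelow k g
sum-mono zero f≤g = z≤n
sum-mono (suc k) f≤g = +-mono-≤ (f≤g 0) (sum-mono k (f≤g ∘ suc))

sum-+ : ∀ k (f g : ℕ → ℕ) → sumBelow k (λ n → f n + g n) ≡ sumBelow k f + sumBelow k g
sum-+ zero f g = refl
sum-+ (suc k) f g =
  trans (cong (f 0 + g 0 +_) (sum-+ k (f ∘ suc) (g ∘ suc))) (interchange (f 0) (g 0) _ _)

sum-ones : ∀ k → sumBelow k (λ _ → 1) ≡ k
sum-ones zero = refl
sum-ones (suc k) = cong suc (sum-ones k)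

sum-snoc : ∀ k g → sumBelow (suc k) g ≡ sumBelow k g + g k
sum-snoc zero g = +-comm (g 0) 0
sum-snoc (suc k) g = trans (cong (g 0 +_) (sum-snoc k (g ∘ suc))) (sym (+-assoc (g 0) _ _))

sum-shift-one : ∀ k g → g k ≡ g 0 → sumBelow k (g ∘ suc) ≡ sumBelow k g
sum-shift-one k g gk≡g0 = +-cancelˡ-≡ (g 0) _ _ (begin
    g 0 + sumBelow k (g ∘ suc)   ≡⟨ sum-snoc k g ⟩
    sumBelow k g + g k           ≡⟨ cong (sumBelow k g +_) gk≡g0 ⟩
    sumBelow k g + g 0           ≡⟨ +-comm (sumBelow k g) (g 0) ⟩
    g 0 + sumBelow k g           ∎)
  where open ≡-Reasoning

sum-rotate : ∀ m g → (∀ n → g (n + m) ≡ g n) → ∀ k → sumBelow m (λ n → g (k + n)) ≡ sumBelow m g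
sum-rotate m g periodic zero = refl
sum-rotate m g periodic (suc k) =
  trans (sum-rotate m (g ∘ suc) (periodic ∘ suc) k) (sum-shift-one m g (periodic 0))

half-bound : ∀ {m k} → m ≤ k + k → suc m / 2 ≤ k
half-bound {m} {k} m≤2k = ≤-pred (m<n*o⇒m/o<n (s≤s (s≤s (≤-trans m≤2k (≤-reflexive k+k≡k*2)))))
  where
  k+k≡k*2 : k + k ≡ k * 2
  k+k≡k*2 = trans (cong (k +_) (sym (+-identityʳ k))) (*-comm 2 k)

indicator : Bool → ℕ
indicator true = 1
indicator false = 0

indicator-complement : ∀ a → indicator a + indicator (not a) ≡ 1
indicator-complement true = refl
indicator-complement false = refl

singleGap doubleGap : Bool → Bool → ℕ
singleGap true _ = 0
singleGap false next = indicator next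
doubleGap true _ = 0
doubleGap false next = indicator (not next)

gap-split : ∀ a b → indicator (not a) ≡ singleGap a b + doubleGap a b
gap-split true _ = refl
gap-split false true = refl
gap-split false false = refl

singleGap≤next : ∀ a b → singleGap a b ≤ indicator b
singleGap≤next true _ = z≤n
singleGap≤next false _ = ≤-refl

-- Charging on four consecutive positions a b c d.  Without a double gap at a,
-- only a single gap at c is charged to d, and it needs d present.  A double
-- gap at a forces c and d present, so then c is no gap and d absorbs only it.
charge : ∀ a b c d → (a ≡ false → b ≡ false → c ≡ true × d ≡ true) →
  singleGap c d + doubleGap a b ≤ indicator d
charge true b c d _ = ≤-trans (≤-reflexive (+-identityʳ _)) (singleGap≤next c d)
charge false true c d _ = ≤-trans (≤-reflexive (+-identityʳ _)) (singleGap≤next c d)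
charge false false c d forced with forced refl refl
... | refl , refl = ≤-refl

GapPairRule : (ℕ → Bool) → Set
GapPairRule x = ∀ n → x n ≡ false → x (1 + n) ≡ false → x (2 + n) ≡ true × x (3 + n) ≡ true

module GapCounting (m : ℕ) (x : ℕ → Bool) (periodic : ∀ n → x (n + m) ≡ x n) (rule : GapPairRule x) where

  present absent single double : ℕ → ℕ
  present n = indicator (x n)
  absent n = indicator (not (x n))
  single n = singleGap (x n) (x (suc n))
  double n = doubleGap (x n) (x (suc n))

  absent≤present : sumBelow m absent ≤ sumBelow m present
  absent≤present = begin
    sumBelow m absent                                     ≡⟨ sum-cong m (λ n → gap-split (x n) (x (suc n))) ⟩
    sumBelow m (λ n → single n + double n)                ≡⟨ sum-+ m single double ⟩
    sumBelow m single + sumBelow m double                 ≡⟨ cong (_+ sumBelow m double) (sum-rotate m single singlePeriodic 2) ⟨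
    sumBelow m (λ n → single (2 + n)) + sumBelow m double ≡⟨ sum-+ m (λ n → single (2 + n)) double ⟨
    sumBelow m (λ n → single (2 + n) + double n)          ≤⟨ sum-mono m (λ n → charge (x n) (x (1 + n)) (x (2 + n)) (x (3 + n)) (rule n)) ⟩
    sumBelow m (λ n → present (3 + n))                    ≡⟨ sum-rotate m present (cong indicator ∘ periodic) 3 ⟩
    sumBelow m present                                    ∎
    where
    open ≤-Reasoning
    singlePeriodic : ∀ n → single (n + m) ≡ single n
    singlePeriodic n = cong₂ singleGap (periodic n) (periodic (suc n))

  at-least-half-present : suc m / 2 ≤ sumBelow m present
  at-least-half-present = half-bound (begin
    m                                          ≡⟨ sum-ones m ⟨
    sumBelow m (λ _ → 1)                       ≡⟨ sum-cong m (λ n → indicator-complement (x n)) ⟨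
    sumBelow m (λ n → present n + absent n)    ≡⟨ sum-+ m present absent ⟩
    sumBelow m present + sumBelow m absent     ≤⟨ +-monoʳ-≤ (sumBelow m present) absent≤present ⟩
    sumBelow m present + sumBelow m present    ∎)
    where open ≤-Reasoning

cycleSequence : ∀ {p} → Subset (suc (suc p)) → ℕ → Bool
cycleSequence {p} X n = lookup (tail X) (n mod suc p)

cycleSequence-periodic : ∀ {p} (X : Subset (suc (suc p))) → ∀ n → cycleSequence X (n + suc p) ≡ cycleSequence X n
cycleSequence-periodic {p} X n = cong (lookup (tail X)) (CycleIndex.mod-periodic p n)

count-as-sum : ∀ {k} (v : Vec Bool k) (g : ℕ → Bool) → (∀ i → g (toℕ i) ≡ lookup v i) →
  ∣ v ∣ ≡ sumBelow k (indicator ∘ g)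
count-as-sum [] g agree = refl
count-as-sum {suc k} (a ∷ v) g agree = begin
    ∣ a ∷ v ∣                                   ≡⟨ size-cons a v ⟩
    indicator a + ∣ v ∣                         ≡⟨ cong₂ _+_ (cong indicator (sym (agree F.zero)))
                                                             (count-as-sum v (g ∘ suc) (agree ∘ F.suc)) ⟩
    indicator (g 0) + sumBelow k (indicator ∘ g ∘ suc) ∎
  where
  open ≡-Reasoning
  size-cons : ∀ {k} a (v : Vec Bool k) → ∣ a ∷ v ∣ ≡ indicator a + ∣ v ∣
  size-cons true v = refl
  size-cons false v = refl

cycle-count : ∀ {p} (X : Subset (suc (suc p))) → ∣ tail X ∣ ≡ sumBelow (suc p) (indicator ∘ cycleSequence X)
cycle-count {p} X = count-as-sum (tail X) (cycleSequence X) (cong (lookup (tail X)) ∘ CycleIndex.toℕ-mod-id p)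

condX⇒gapPairRule : ∀ {p} (X : Subset (suc (suc p))) → CondX X → GapPairRule (cycleSequence X)
condX⇒gapPairRule {p} X cond n absent₀ absent₁ =
  present 2 (proj₁ (proj₂ (proj₂ forced))) , present 3 (proj₂ (proj₂ (proj₂ forced)))
  where
  open CycleIndex p
  i : Fin m
  i = n mod m
  shifted : ∀ k → i ⊕ k ≡ (k + n) mod m
  shifted k = trans (mod-⊕ n k) (cong (λ r → r mod m) (+-comm n k))
  present : ∀ k → cyc (i ⊕ k) ∈ X → cycleSequence X (k + n) ≡ true
  present k c∈X = trans (cong (lookup (tail X)) (sym (shifted k))) ([]=⇒lookup (tail-member⁻ c∈X))
  notMember : ∀ {j} → lookup (tail X) j ≡ false → cyc j ∉ X
  notMember absentAt c∈X with () ← trans (sym absentAt) ([]=⇒lookup (tail-member⁻ c∈X))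
  forced : (cyc (i ⊕ (m ∸ 2)) ∈ X) × (cyc (i ⊕ (m ∸ 1)) ∈ X) × (cyc (i ⊕ 2) ∈ X) × (cyc (i ⊕ 3) ∈ X)
  forced = cond i (notMember absent₀) (notMember (trans (cong (lookup (tail X)) (shifted 1)) absent₁))

at-least-half-cycle : ∀ {p} (X : Subset (suc (suc p))) → CondX X → suc (suc p) / 2 ≤ ∣ tail X ∣
at-least-half-cycle {p} X cond = subst (suc (suc p) / 2 ≤_) (sym (cycle-count X))
  (GapCounting.at-least-half-present (suc p) (cycleSequence X) (cycleSequence-periodic X) (condX⇒gapPairRule X cond))

-- Statement (2): discard c_{i+1} and c_{i-1} from L ∩ C; two of the at least
-- two remaining cycle vertices of L are non-neighbours of c_i.
hub-cycle-pair-separated : (p : ℕ) (L : Subset (suc (suc p))) → 4 ≤ ∣ tail L ∣ →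
  (i : Fin (suc p)) → SepByAtLeastCyc 2 L hub (cyc i)
hub-cycle-pair-separated p L size i
  with two-distinct-elements (tail L - (i ⊕ 1) - (i ⊕ p)) (size-two-removals (tail L) (i ⊕ 1) (i ⊕ p) size)
... | j₁ , j₂ , j₁∈ , j₂∈ , j₁≢j₂ =
  pair j₁ j₂ , pair-injective j₁≢j₂ , λ { F.zero → separator j₁∈ ; (F.suc _) → separator j₂∈ }
  where
  open CycleIndex p
  separator : ∀ {j} → j ∈ tail L - (i ⊕ 1) - (i ⊕ p) → cyc j ∈ L × Separates hub (cyc i) (cyc j)
  separator j∈ with member-of-removal j∈
  ... | j∈' , j≢prev with member-of-removal j∈'
  ... | j∈L , j≢next =
    tail-member j∈L , non-neighbour-separates i _ j≢next (λ i≡j+1 → j≢prev (predecessor i≡j+1))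

cycle-in-L-hub : ∀ {p} {L : Subset (suc (suc p))} {j : Fin (suc p)} → cyc j ∈ L → cyc j ∈ L - hub
cycle-in-L-hub c∈L = x∈p∧x≢y⇒x∈p-y {y = hub} c∈L (λ ())

cycle-separators-drop-hub : ∀ {p k} {L : Subset (suc (suc p))} {u v : V p} →
  SepByAtLeastCyc k L u v → SepByAtLeast k (L - hub) u v
cycle-separators-drop-hub (f , f-injective , good) =
  cyc ∘ f , f-injective ∘ suc-injective , λ r → cycle-in-L-hub (proj₁ (good r)) , proj₂ (good r)

sepByAtLeast-sym : ∀ {p k} {L : Subset (suc (suc p))} {u v : V p} → SepByAtLeast k L u v → SepByAtLeast k L v u
sepByAtLeast-sym (f , f-injective , good) = f , f-injective , λ r → proj₁ (good r) , separates-sym (proj₂ (good r))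

-- Separators of two cycle vertices are never the hub.
cycle-pair-drop-hub : ∀ {p k} {L : Subset (suc (suc p))} (i j : Fin (suc p)) →
  SepByAtLeast k L (cyc i) (cyc j) → SepByAtLeast k (L - hub) (cyc i) (cyc j)
cycle-pair-drop-hub i j (f , f-injective , good) = f , f-injective , λ r →
  x∈p∧x≢y⇒x∈p-y (proj₁ (good r))
    (λ f≡hub → hub-separates-no-cycle-pair i j (subst (Separates (cyc i) (cyc j)) f≡hub (proj₂ (good r))))
  , proj₂ (good r)

drop-hub : (p : ℕ) (L : Subset (suc (suc p))) → 4 ≤ ∣ tail L ∣ → NLLandmark 2 L → NLLandmark 2 (L - hub)
drop-hub p L size landmark F.zero F.zero u≢v _ _ = ⊥-elim (u≢v refl)
drop-hub p L size landmark F.zero (F.suc j) _ _ _ =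
  cycle-separators-drop-hub (hub-cycle-pair-separated p L size j)
drop-hub p L size landmark (F.suc i) F.zero _ _ _ =
  sepByAtLeast-sym (cycle-separators-drop-hub (hub-cycle-pair-separated p L size i))
drop-hub p L size landmark (F.suc i) (F.suc j) u≢v u∉ v∉ =
  cycle-pair-drop-hub i j (landmark (cyc i) (cyc j) u≢v (u∉ ∘ cycle-in-L-hub) (v∉ ∘ cycle-in-L-hub))

mainTheorem17 : (p : ℕ) → 6 ≤ suc (suc p) →
    ((X : Subset (suc (suc p))) → CondX X → suc (suc p) / 2 ≤ ∣ tail X ∣)
    × ((L : Subset (suc (suc p))) → 4 ≤ ∣ tail L ∣ →
    ((i : Fin (suc p)) → SepByAtLeastCyc 2 L hub (cyc i))
    × (NLLandmark 2 L → NLLandmark 2 (L - hub)))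
mainTheorem17 p _ =
  at-least-half-cycle ,
  λ L size → hub-cycle-pair-separated p L size , drop-hub p L size
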